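{- Let $\mathbf{X}$ be a represented space and let $\iota_1:\mathbf{X}\hookrightarrow \mathbf{Y}_1$ and $\iota_2:\mathbf{X}\hookrightarrow\mathbf{Y}_2$ be two completions of $\mathbf{X}$. Then there is a computable multivalued function $T:\mathbf{Y}_1\rightrightarrows \mathbf{Y}_2$ such that $\iota_2 = T\circ\iota_1$.
   Context: Represented spaces have representations $\delta:\subseteq\{0,1\}^\mathbb{N}\to\mathbf{X}$. A represented space $\mathbf{Y}$ is multiretraceable if every computable partial function $f:\subseteq\{0,1\}^\mathbb{N}\to\mathbf{Y}$ has a total computable extension $F:\{0,1\}^\mathbb{N}\to\mathbf{Y}$. A completion of a represented space $\mathbf{X}$ is a computable embedding $\iota:\mathbf{X}\hookrightarrow\mathbf{Y}$ into a multiretraceable represented space $\mathbf{Y}$. -}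

module Defs where

open import Data.Nat using (ℕ; zero; suc; _+_; _*_; _≤_)
open import Data.Fin using (Fin)
open import Data.Vec using (Vec; []; _∷_; lookup)
open import Data.List using (List; []; _∷_; length)
open import Data.Bool using (Bool; true; false)
open import Data.Product using (Σ; ∃; _×_; _,_)
open import Relation.Binary.PropositionalEquality using (_≡_)

data PR : ℕ → Set where
  zer  : ∀ {n} → PR n
  succ : PR 1
  proj : ∀ {n} → Fin n → PR n
  comp : ∀ {m n} → PR m → Vec (PR n) m → PR n
  rec  : ∀ {n} → PR n → PR (suc (suc n)) → PR (suc n)
  mu   : ∀ {n} → PR (suc n) → PR n

mutual
  data Eval : ∀ {n} → PR n → Vec ℕ n → ℕ → Set where
    ev-zer  : ∀ {n} {xs : Vec ℕ n} → Eval zer xs 0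
    ev-succ : ∀ {x} → Eval succ (x ∷ []) (suc x)
    ev-proj : ∀ {n} {i : Fin n} {xs} → Eval (proj i) xs (lookup xs i)
    ev-comp : ∀ {m n} {f : PR m} {gs : Vec (PR n) m} {xs ys y} →
              EvalAll gs xs ys → Eval f ys y → Eval (comp f gs) xs y
    ev-rec0 : ∀ {n} {f : PR n} {g} {xs y} →
              Eval f xs y → Eval (rec f g) (0 ∷ xs) y
    ev-recS : ∀ {n} {f : PR n} {g} {k xs r y} →
              Eval (rec f g) (k ∷ xs) r → Eval g (k ∷ r ∷ xs) y →
              Eval (rec f g) (suc k ∷ xs) y
    ev-mu   : ∀ {n} {f : PR (suc n)} {xs y} →
              MuFrom f xs 0 y → Eval (mu f) xs y

  data EvalAll : ∀ {m n} → Vec (PR n) m → Vec ℕ n → Vec ℕ m → Set where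
    ev-[] : ∀ {n} {xs : Vec ℕ n} → EvalAll [] xs []
    ev-∷  : ∀ {m n} {g : PR n} {gs : Vec (PR n) m} {xs y ys} →
            Eval g xs y → EvalAll gs xs ys → EvalAll (g ∷ gs) xs (y ∷ ys)

  -- MuFrom f xs i y : y is the least j ≥ i with f (j ∷ xs) = 0,
  -- and f (k ∷ xs) is defined for all i ≤ k < y
  data MuFrom : ∀ {n} → PR (suc n) → Vec ℕ n → ℕ → ℕ → Set where
    mu-found : ∀ {n} {f : PR (suc n)} {xs i} →
               Eval f (i ∷ xs) 0 → MuFrom f xs i i
    mu-next  : ∀ {n} {f : PR (suc n)} {xs i m y} →
               Eval f (i ∷ xs) (suc m) → MuFrom f xs (suc i) y → MuFrom f xs i y

-- Finite binary words, coded bijectively as natural numbers.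

enc : List Bool → ℕ
enc []            = 0
enc (false ∷ w)   = 1 + 2 * enc w
enc (true  ∷ w)   = 2 + 2 * enc w

ComputableWordMap : (List Bool → List Bool) → Set
ComputableWordMap h = Σ (PR 1) λ c → ∀ w → Eval c (enc w ∷ []) (enc (h w))

Cantor : Set
Cantor = ℕ → Bool

prefix : Cantor → ℕ → List Bool
prefix p zero    = []
prefix p (suc n) = p 0 ∷ prefix (λ i → p (suc i)) n

-- The word-machine h, reading longer and longer prefixes of p, outputs q:
-- all outputs are prefixes of q, and arbitrarily long ones occur.
Computes : (List Bool → List Bool) → Cantor → Cantor → Set
Computes h p q =
  (∀ k → h (prefix p k) ≡ prefix q (length (h (prefix p k)))) ×
  (∀ n → ∃ λ k → n ≤ length (h (prefix p k)))

record Machine : Set where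
  field
    run        : List Bool → List Bool
    computable : ComputableWordMap run
open Machine public

-- Represented spaces: δ :⊆ {0,1}^ℕ → X a partial surjection,
-- given as the relation "p is a δ-name of x".

record RepSpace : Set₁ where
  field
    Carrier    : Set
    δ          : Cantor → Carrier → Set
    functional : ∀ {p x y} → δ p x → δ p y → x ≡ y
    surjective : ∀ x → ∃ λ p → δ p x
open RepSpace public

module _ (X Y : RepSpace) where
  private
    module X = RepSpace X
    module Y = RepSpace Y

  IsComputable : (X.Carrier → Y.Carrier) → Set
  IsComputable g = Σ Machine λ M →
    ∀ p x → X.δ p x → ∃ λ q → Computes (run M) p q × Y.δ q (g x)

  IsComputableEmbedding : (X.Carrier → Y.Carrier) → Set
  IsComputableEmbedding ι =
    IsComputable ι ×
    (∀ x x' → ι x ≡ ι x' → x ≡ x') ×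
    (Σ Machine λ M → ∀ p x → Y.δ p (ι x) →
        ∃ λ q → Computes (run M) p q × X.δ q x)

  IsMultivalued : (X.Carrier → Y.Carrier → Set) → Set
  IsMultivalued T = ∀ x → ∃ λ y → T x y

  IsComputableMV : (X.Carrier → Y.Carrier → Set) → Set
  IsComputableMV T = Σ Machine λ M →
    ∀ p x → X.δ p x → ∃ λ q → Computes (run M) p q × Σ Y.Carrier λ y → Y.δ q y × T x y

IsComputablePartial : (Y : RepSpace) (D : Cantor → Set) →
                      ((p : Cantor) → D p → Carrier Y) → Set
IsComputablePartial Y D f = Σ Machine λ M →
  ∀ p (d : D p) → ∃ λ q → Computes (run M) p q × δ Y q (f p d)

IsComputableTotal : (Y : RepSpace) → (Cantor → Carrier Y) → Set
IsComputableTotal Y F = Σ Machine λ M →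
  ∀ p → ∃ λ q → Computes (run M) p q × δ Y q (F p)

Multiretraceable : RepSpace → Set₁
Multiretraceable Y =
  (D : Cantor → Set) (f : (p : Cantor) → D p → Carrier Y) →
  IsComputablePartial Y D f →
  Σ (Cantor → Carrier Y) λ F → IsComputableTotal Y F × (∀ p (d : D p) → F p ≡ f p d)

record Completion (X : RepSpace) : Set₁ where
  field
    Y          : RepSpace
    ι          : Carrier X → Carrier Y
    embedding  : IsComputableEmbedding X Y ι
    multiretr  : Multiretraceable Y

{-# OPTIONS --safe #-}
-- Composing a realizer of ι₁⁻¹ with a realizer of ι₂ yields a computable
-- partial map p ↦ ι₂ (ι₁⁻¹ (δ₁ p)) on the names of points of ι₁(X).
-- Multiretraceability of Y₂ extends it to a total computable F, and
-- T y := { F p | p a name of y } is then a computable multivalued map with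
-- T ∘ ι₁ = ι₂. The real work is composing type-2 machines given as word
-- functions: the outputs of the second machine on longer inputs need not get
-- longer, so the composite outputs the longest of its outputs on all
-- prefixes of the first machine's output, which is again computable.
module Submission where

open import Defs
open import Data.Product using (Σ; _×_)
open import Relation.Binary.PropositionalEquality using (_≡_)
open import Function.Bundles using (_⇔_)

open import Data.Bool using (Bool; true; false)
open import Data.Fin using (#_)
open import Data.List using (List; []; _∷_; length; take; drop)
open import Data.List.Properties using (drop-drop)
open import Data.Nat
  using (ℕ; zero; suc; pred; _+_; _*_; _^_; _∸_; _⊓_; _⊔_; _≤_; _<_; z≤n; s≤s; ⌊_/2⌋; ⌈_/2⌉)
open import Data.Nat.Properties
open import Data.Product using (∃; _,_; proj₁; proj₂)
open import Data.Sum using (inj₁; inj₂)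
open import Data.Vec using ([]; _∷_)
open import Function.Bundles using (mk⇔)
open import Relation.Nullary using (yes; no)
open import Relation.Binary.PropositionalEquality
  using (refl; sym; trans; cong; cong₂; subst; subst₂; module ≡-Reasoning)

ev-comp₁ : ∀ {n} {f : PR 1} {g : PR n} {xs y z} →
           Eval g xs y → Eval f (y ∷ []) z → Eval (comp f (g ∷ [])) xs z
ev-comp₁ g↓ f↓ = ev-comp (ev-∷ g↓ ev-[]) f↓

ev-comp₂ : ∀ {n} {f : PR 2} {g h : PR n} {xs y y′ z} →
           Eval g xs y → Eval h xs y′ → Eval f (y ∷ y′ ∷ []) z →
           Eval (comp f (g ∷ h ∷ [])) xs z
ev-comp₂ g↓ h↓ f↓ = ev-comp (ev-∷ g↓ (ev-∷ h↓ ev-[])) f↓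

plus : PR 2
plus = rec (proj (# 0)) (comp succ (proj (# 1) ∷ []))

plus-eval : ∀ m n → Eval plus (m ∷ n ∷ []) (m + n)
plus-eval zero    n = ev-rec0 ev-proj
plus-eval (suc m) n = ev-recS (plus-eval m n) (ev-comp₁ ev-proj ev-succ)

times : PR 2
times = rec zer (comp plus (proj (# 2) ∷ proj (# 1) ∷ []))

times-eval : ∀ m n → Eval times (m ∷ n ∷ []) (m * n)
times-eval zero    n = ev-rec0 ev-zer
times-eval (suc m) n = ev-recS (times-eval m n) (ev-comp₂ ev-proj ev-proj (plus-eval n (m * n)))

exp2 : PR 1
exp2 = rec (comp succ (zer ∷ [])) (comp plus (proj (# 1) ∷ proj (# 1) ∷ []))

exp2-eval : ∀ n → Eval exp2 (n ∷ []) (2 ^ n)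
exp2-eval zero    = ev-rec0 (ev-comp₁ ev-zer ev-succ)
exp2-eval (suc n) =
  subst (Eval exp2 (suc n ∷ [])) (cong (2 ^ n +_) (sym (+-identityʳ (2 ^ n))))
    (ev-recS (exp2-eval n) (ev-comp₂ ev-proj ev-proj (plus-eval (2 ^ n) (2 ^ n))))

predecessor : PR 1
predecessor = rec zer (proj (# 0))

predecessor-eval : ∀ n → Eval predecessor (n ∷ []) (pred n)
predecessor-eval zero    = ev-rec0 ev-zer
predecessor-eval (suc n) = ev-recS (predecessor-eval n) ev-proj

-- Recursion runs on the first argument, so monus (m ∷ n ∷ []) computes n ∸ m.
monus : PR 2
monus = rec (proj (# 0)) (comp predecessor (proj (# 1) ∷ []))

monus-eval : ∀ m n → Eval monus (m ∷ n ∷ []) (n ∸ m)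
monus-eval zero    n = ev-rec0 ev-proj
monus-eval (suc m) n =
  subst (Eval monus (suc m ∷ n ∷ [])) (pred[m∸n]≡m∸[1+n] n m)
    (ev-recS (monus-eval m n) (ev-comp₁ ev-proj (predecessor-eval (n ∸ m))))

⌊1+n/2⌋≡n∸⌊n/2⌋ : ∀ n → ⌊ suc n /2⌋ ≡ n ∸ ⌊ n /2⌋
⌊1+n/2⌋≡n∸⌊n/2⌋ n = sym (begin
  n ∸ ⌊ n /2⌋                   ≡⟨ cong (_∸ ⌊ n /2⌋) (sym (⌊n/2⌋+⌈n/2⌉≡n n)) ⟩
  ⌊ n /2⌋ + ⌈ n /2⌉ ∸ ⌊ n /2⌋   ≡⟨ m+n∸m≡n ⌊ n /2⌋ ⌈ n /2⌉ ⟩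
  ⌈ n /2⌉                       ∎)
  where open ≡-Reasoning

half : PR 1
half = rec zer (comp monus (proj (# 1) ∷ proj (# 0) ∷ []))

half-eval : ∀ n → Eval half (n ∷ []) ⌊ n /2⌋
half-eval zero    = ev-rec0 ev-zer
half-eval (suc n) =
  subst (Eval half (suc n ∷ [])) (sym (⌊1+n/2⌋≡n∸⌊n/2⌋ n))
    (ev-recS (half-eval n) (ev-comp₂ ev-proj ev-proj (monus-eval ⌊ n /2⌋ n)))

m+[n∸m]≡m⊔n : ∀ m n → m + (n ∸ m) ≡ m ⊔ n
m+[n∸m]≡m⊔n m n with ≤-total m n
... | inj₁ m≤n = trans (m+[n∸m]≡n m≤n) (sym (m≤n⇒m⊔n≡n m≤n))
... | inj₂ n≤m =
  trans (cong (m +_) (m≤n⇒m∸n≡0 n≤m)) (trans (+-identityʳ m) (sym (m≥n⇒m⊔n≡m n≤m)))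

maximum : PR 2
maximum = comp plus (proj (# 0) ∷ comp monus (proj (# 0) ∷ proj (# 1) ∷ []) ∷ [])

maximum-eval : ∀ m n → Eval maximum (m ∷ n ∷ []) (m ⊔ n)
maximum-eval m n =
  subst (Eval maximum (m ∷ n ∷ [])) (m+[n∸m]≡m⊔n m n)
    (ev-comp₂ ev-proj (ev-comp₂ ev-proj ev-proj (monus-eval m n)) (plus-eval m (n ∸ m)))

bit : Bool → ℕ
bit false = 1
bit true  = 2

enc-∷ : ∀ b w → enc (b ∷ w) ≡ bit b + 2 * enc w
enc-∷ false w = refl
enc-∷ true  w = refl

enc-take-drop : ∀ j w → enc w ≡ enc (take j w) + 2 ^ j * enc (drop j w)
enc-take-drop zero    w       = sym (+-identityʳ (enc w))
enc-take-drop (suc j) []      = sym (*-zeroʳ (2 ^ suc j))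
enc-take-drop (suc j) (b ∷ w) = begin
  enc (b ∷ w)                         ≡⟨ enc-∷ b w ⟩
  bit b + 2 * enc w                   ≡⟨ cong (λ t → bit b + 2 * t) (enc-take-drop j w) ⟩
  bit b + 2 * (T + 2 ^ j * D)         ≡⟨ cong (bit b +_) (*-distribˡ-+ 2 T (2 ^ j * D)) ⟩
  bit b + (2 * T + 2 * (2 ^ j * D))   ≡⟨ sym (+-assoc (bit b) (2 * T) _) ⟩
  bit b + 2 * T + 2 * (2 ^ j * D)     ≡⟨ cong₂ _+_ (sym (enc-∷ b (take j w)))
                                                   (sym (*-assoc 2 (2 ^ j) D)) ⟩
  enc (b ∷ take j w) + 2 ^ suc j * D  ∎
  where
    open ≡-Reasoning
    T D : ℕ
    T = enc (take j w)
    D = enc (drop j w)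

⌊pred[enc]/2⌋≡enc[tail] : ∀ w → ⌊ pred (enc w) /2⌋ ≡ enc (drop 1 w)
⌊pred[enc]/2⌋≡enc[tail] []          = refl
⌊pred[enc]/2⌋≡enc[tail] (false ∷ w) rewrite +-identityʳ (enc w) = sym (n≡⌊n+n/2⌋ (enc w))
⌊pred[enc]/2⌋≡enc[tail] (true  ∷ w) rewrite +-identityʳ (enc w) = sym (n≡⌈n+n/2⌉ (enc w))

tailCode : PR 1
tailCode = comp half (comp predecessor (proj (# 0) ∷ []) ∷ [])

tailCode-eval : ∀ w → Eval tailCode (enc w ∷ []) (enc (drop 1 w))
tailCode-eval w =
  subst (Eval tailCode (enc w ∷ [])) (⌊pred[enc]/2⌋≡enc[tail] w)
    (ev-comp₁ (ev-comp₁ ev-proj (predecessor-eval (enc w))) (half-eval (pred (enc w))))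

dropCode : PR 2
dropCode = rec (proj (# 0)) (comp tailCode (proj (# 1) ∷ []))

dropCode-eval : ∀ j w → Eval dropCode (j ∷ enc w ∷ []) (enc (drop j w))
dropCode-eval zero    w = ev-rec0 ev-proj
dropCode-eval (suc j) w =
  subst (λ v → Eval dropCode (suc j ∷ enc w ∷ []) (enc v)) drop-1+j
    (ev-recS (dropCode-eval j w) (ev-comp₁ ev-proj (tailCode-eval (drop j w))))
  where
    drop-1+j : drop 1 (drop j w) ≡ drop (suc j) w
    drop-1+j = trans (drop-drop j 1 w) (cong (λ k → drop k w) (+-comm j 1))

-- enc (take j w) is enc w minus the contribution 2 ^ j * enc (drop j w) of the suffix.
takeCode : PR 2
takeCode = comp monus (comp times (comp exp2 (proj (# 0) ∷ []) ∷ dropCode ∷ []) ∷ proj (# 1) ∷ [])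

takeCode-eval : ∀ j w → Eval takeCode (j ∷ enc w ∷ []) (enc (take j w))
takeCode-eval j w =
  subst (Eval takeCode (j ∷ enc w ∷ [])) enc-take
    (ev-comp₂ (ev-comp₂ (ev-comp₁ ev-proj (exp2-eval j)) (dropCode-eval j w) (times-eval _ _))
              ev-proj (monus-eval _ _))
  where
    enc-take : enc w ∸ 2 ^ j * enc (drop j w) ≡ enc (take j w)
    enc-take = trans (cong (_∸ 2 ^ j * enc (drop j w)) (enc-take-drop j w))
                     (m+n∸n≡m (enc (take j w)) (2 ^ j * enc (drop j w)))

length≤enc : ∀ w → length w ≤ enc w
length≤enc []          = z≤n
length≤enc (false ∷ w) = s≤s (≤-trans (length≤enc w) (m≤m+n (enc w) _))
length≤enc (true  ∷ w) = s≤s (m≤n⇒m≤1+n (≤-trans (length≤enc w) (m≤m+n (enc w) _)))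

_⊑_ : List Bool → Cantor → Set
w ⊑ r = w ≡ prefix r (length w)

take-prefix : ∀ (r : Cantor) j n → take j (prefix r n) ≡ prefix r (j ⊓ n)
take-prefix r zero    n       = refl
take-prefix r (suc j) zero    = refl
take-prefix r (suc j) (suc n) = cong (r 0 ∷_) (take-prefix (λ i → r (suc i)) j n)

take-⊑ : ∀ {w r} j → w ⊑ r → take j w ≡ prefix r (j ⊓ length w)
take-⊑ {w} {r} j w⊑r = trans (cong (take j) w⊑r) (take-prefix r j (length w))

enc-∷-<  : ∀ b {v w} → enc v < enc w → enc (b ∷ v) < enc (b ∷ w)
enc-∷-< false v<w = +-monoʳ-< 1 (*-monoʳ-< 2 v<w)
enc-∷-< true  v<w = +-monoʳ-< 2 (*-monoʳ-< 2 v<w)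

0<enc-∷ : ∀ b w → 0 < enc (b ∷ w)
0<enc-∷ false w = s≤s z≤n
0<enc-∷ true  w = s≤s z≤n

enc-prefix-< : ∀ r {m n} → m < n → enc (prefix r m) < enc (prefix r n)
enc-prefix-< r {zero}  {suc n} _         = 0<enc-∷ (r 0) _
enc-prefix-< r {suc m} {suc n} (s≤s m<n) = enc-∷-< (r 0) (enc-prefix-< (λ i → r (suc i)) m<n)

enc-≤⇒length-≤ : ∀ {v w r} → v ⊑ r → w ⊑ r → enc v ≤ enc w → length v ≤ length w
enc-≤⇒length-≤ {v} {w} {r} v⊑r w⊑r enc-v≤enc-w = ≮⇒≥ λ |w|<|v| →
  <⇒≱ (subst₂ (λ a b → enc a < enc b) (sym w⊑r) (sym v⊑r) (enc-prefix-< r |w|<|v|)) enc-v≤enc-w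

-- On prefixes of a common stream, a larger code means a longer word.
longer : List Bool → List Bool → List Bool
longer v w with enc v ≤? enc w
... | yes _ = w
... | no  _ = v

enc-longer : ∀ v w → enc (longer v w) ≡ enc v ⊔ enc w
enc-longer v w with enc v ≤? enc w
... | yes v≤w = sym (m≤n⇒m⊔n≡n v≤w)
... | no  v≰w = sym (m≥n⇒m⊔n≡m (<⇒≤ (≰⇒> v≰w)))

longer-⊑ : ∀ {v w r} → v ⊑ r → w ⊑ r → longer v w ⊑ r
longer-⊑ {v} {w} v⊑r w⊑r with enc v ≤? enc w
... | yes _ = w⊑r
... | no  _ = v⊑r

length-longerˡ : ∀ {v w r} → v ⊑ r → w ⊑ r → length v ≤ length (longer v w)
length-longerˡ {v} {w} v⊑r w⊑r with enc v ≤? enc w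
... | yes v≤w = enc-≤⇒length-≤ v⊑r w⊑r v≤w
... | no  _   = ≤-refl

length-longerʳ : ∀ {v w r} → v ⊑ r → w ⊑ r → length w ≤ length (longer v w)
length-longerʳ {v} {w} v⊑r w⊑r with enc v ≤? enc w
... | yes _   = ≤-refl
... | no  v≰w = enc-≤⇒length-≤ w⊑r v⊑r (<⇒≤ (≰⇒> v≰w))

module _ (h : List Bool → List Bool) where

  longestOnPrefixes : ℕ → List Bool → List Bool
  longestOnPrefixes zero    u = h []
  longestOnPrefixes (suc i) u = longer (longestOnPrefixes i u) (h (take (suc i) u))

  module _ {u r} (h-take-⊑ : ∀ j → h (take j u) ⊑ r) where

    longestOnPrefixes-⊑ : ∀ i → longestOnPrefixes i u ⊑ r
    longestOnPrefixes-⊑ zero    = h-take-⊑ 0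
    longestOnPrefixes-⊑ (suc i) = longer-⊑ (longestOnPrefixes-⊑ i) (h-take-⊑ (suc i))

    length-longestOnPrefixes : ∀ {i j} → j ≤ i →
                               length (h (take j u)) ≤ length (longestOnPrefixes i u)
    length-longestOnPrefixes {zero}  z≤n = ≤-refl
    length-longestOnPrefixes {suc i} j≤1+i with m≤n⇒m<n∨m≡n j≤1+i
    ... | inj₁ (s≤s j≤i) = ≤-trans (length-longestOnPrefixes j≤i)
                                   (length-longerˡ (longestOnPrefixes-⊑ i) (h-take-⊑ (suc i)))
    ... | inj₂ refl      = length-longerʳ (longestOnPrefixes-⊑ i) (h-take-⊑ (suc i))

  longestOnPrefixes-computable : ComputableWordMap h →
    Σ (PR 2) λ c → ∀ i u → Eval c (i ∷ enc u ∷ []) (enc (longestOnPrefixes i u))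
  longestOnPrefixes-computable (c , c-eval) = code , code-eval
    where
      hNext : PR 3
      hNext = comp c (comp takeCode (comp succ (proj (# 0) ∷ []) ∷ proj (# 2) ∷ []) ∷ [])

      hNext-eval : ∀ i v u → Eval hNext (i ∷ v ∷ enc u ∷ []) (enc (h (take (suc i) u)))
      hNext-eval i v u =
        ev-comp₁ (ev-comp₂ (ev-comp₁ ev-proj ev-succ) ev-proj (takeCode-eval (suc i) u))
                 (c-eval (take (suc i) u))

      code : PR 2
      code = rec (comp c (zer ∷ [])) (comp maximum (proj (# 1) ∷ hNext ∷ []))

      code-eval : ∀ i u → Eval code (i ∷ enc u ∷ []) (enc (longestOnPrefixes i u))
      code-eval zero    u = ev-rec0 (ev-comp₁ ev-zer (c-eval []))
      code-eval (suc i) u =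
        ev-recS (code-eval i u)
          (subst (Eval _ _) (sym (enc-longer (longestOnPrefixes i u) (h (take (suc i) u))))
            (ev-comp₂ ev-proj (hNext-eval i _ u) (maximum-eval _ _)))

-- Searching up to enc u rather than length u suffices (length≤enc) and
-- avoids computing lengths from codes.
compose : (List Bool → List Bool) → (List Bool → List Bool) → List Bool → List Bool
compose h₂ h₁ w = longestOnPrefixes h₂ (enc (h₁ w)) (h₁ w)

compose-computable : ∀ {h₂ h₁} → ComputableWordMap h₂ → ComputableWordMap h₁ →
                     ComputableWordMap (compose h₂ h₁)
compose-computable {h₂} {h₁} h₂-computable (c₁ , c₁-eval) =
  comp c (c₁ ∷ c₁ ∷ []) , λ w → ev-comp₂ (c₁-eval w) (c₁-eval w) (c-eval (enc (h₁ w)) (h₁ w))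
  where
    c : PR 2
    c = proj₁ (longestOnPrefixes-computable h₂ h₂-computable)
    c-eval : ∀ i u → Eval c (i ∷ enc u ∷ []) (enc (longestOnPrefixes h₂ i u))
    c-eval = proj₂ (longestOnPrefixes-computable h₂ h₂-computable)

compose-computes : ∀ {h₂ h₁ p q r} → Computes h₁ p q → Computes h₂ q r →
                   Computes (compose h₂ h₁) p r
compose-computes {h₂} {h₁} {p} {q} {r} (h₁-⊑ , h₁-unbounded) (h₂-⊑ , h₂-unbounded) =
  compose-⊑ , compose-unbounded
  where
    h₂-take-⊑ : ∀ k j → h₂ (take j (h₁ (prefix p k))) ⊑ r
    h₂-take-⊑ k j = subst (λ v → h₂ v ⊑ r) (sym (take-⊑ j (h₁-⊑ k))) (h₂-⊑ _)

    compose-⊑ : ∀ k → compose h₂ h₁ (prefix p k) ⊑ r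
    compose-⊑ k = longestOnPrefixes-⊑ h₂ (h₂-take-⊑ k) (enc (h₁ (prefix p k)))

    compose-unbounded : ∀ n → ∃ λ k → n ≤ length (compose h₂ h₁ (prefix p k))
    compose-unbounded n with h₂-unbounded n
    ... | j , n≤|h₂[q↾j]| with h₁-unbounded j
    ... | k , j≤|u| = k , (begin
      n                                      ≤⟨ n≤|h₂[q↾j]| ⟩
      length (h₂ (prefix q j))               ≡⟨ cong (λ v → length (h₂ v)) q↾j≡u↾j ⟩
      length (h₂ (take j u))                 ≤⟨ length-longestOnPrefixes h₂ (h₂-take-⊑ k) j≤enc[u] ⟩
      length (compose h₂ h₁ (prefix p k))    ∎)
      where
        open ≤-Reasoning
        u : List Bool
        u = h₁ (prefix p k)
        j≤enc[u] : j ≤ enc u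
        j≤enc[u] = ≤-trans j≤|u| (length≤enc u)
        q↾j≡u↾j : prefix q j ≡ take j u
        q↾j≡u↾j = sym (trans (take-⊑ j (h₁-⊑ k)) (cong (prefix q) (m≤n⇒m⊓n≡m j≤|u|)))

_∘ᴹ_ : Machine → Machine → Machine
M₂ ∘ᴹ M₁ = record
  { run        = compose (run M₂) (run M₁)
  ; computable = compose-computable {run M₂} {run M₁} (computable M₂) (computable M₁)
  }

module _ (X Y : RepSpace) (ι : Carrier X → Carrier Y) where

  NameOfImage : Cantor → Set
  NameOfImage p = Σ (Carrier X) λ x → δ Y p (ι x)

  ∘-inverse-computable : ∀ {Z} {g : Carrier X → Carrier Z} →
                         IsComputableEmbedding X Y ι → IsComputable X Z g →
                         IsComputablePartial Z NameOfImage (λ p x,d → g (proj₁ x,d))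
  ∘-inverse-computable {Z} {g} (_ , _ , ι⁻¹ , ι⁻¹-realizes) (G , G-realizes) =
    G ∘ᴹ ι⁻¹ , realizes
    where
      realizes : ∀ p (x,d : NameOfImage p) →
                 ∃ λ r → Computes (run (G ∘ᴹ ι⁻¹)) p r × δ Z r (g (proj₁ x,d))
      realizes p (x , p↦ιx) with ι⁻¹-realizes p x p↦ιx
      ... | q , ι⁻¹-computes , q↦x with G-realizes q x q↦x
      ... | r , G-computes , r↦gx =
        r , compose-computes {run G} {run ι⁻¹} ι⁻¹-computes G-computes , r↦gx

module _ (Y Z : RepSpace) (F : Cantor → Carrier Z) where

  ImageOfNames : Carrier Y → Carrier Z → Set
  ImageOfNames y z = Σ Cantor λ p → δ Y p y × z ≡ F p

  imageOfNames-multivalued : IsMultivalued Y Z ImageOfNames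
  imageOfNames-multivalued y with surjective Y y
  ... | p , p↦y = F p , p , p↦y , refl

  imageOfNames-computable : IsComputableTotal Z F → IsComputableMV Y Z ImageOfNames
  imageOfNames-computable (M , M-realizes) = M , λ p y p↦y →
    let (q , M-computes , q↦Fp) = M-realizes p in
    q , M-computes , F p , q↦Fp , p , p↦y , refl

  imageOfNames-constant : ∀ y c → (∀ p → δ Y p y → F p ≡ c) →
                          ∀ z → ImageOfNames y z ⇔ (z ≡ c)
  imageOfNames-constant y c F-const z = mk⇔
    (λ (p , p↦y , z≡Fp) → trans z≡Fp (F-const p p↦y))
    (λ z≡c → let (p , p↦y) = surjective Y y in p , p↦y , trans z≡c (sym (F-const p p↦y)))

proposition5 : (X : RepSpace) (C₁ C₂ : Completion X) →
    Σ (Carrier (Completion.Y C₁) → Carrier (Completion.Y C₂) → Set) λ T →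
      IsMultivalued (Completion.Y C₁) (Completion.Y C₂) T ×
      IsComputableMV (Completion.Y C₁) (Completion.Y C₂) T ×
      (∀ x z → T (Completion.ι C₁ x) z ⇔ (z ≡ Completion.ι C₂ x))
proposition5 X C₁ C₂ =
  ImageOfNames Y₁ Y₂ F ,
  imageOfNames-multivalued Y₁ Y₂ F ,
  imageOfNames-computable Y₁ Y₂ F F-computable ,
  λ x → imageOfNames-constant Y₁ Y₂ F (ι₁ x) (ι₂ x) (λ p p↦ι₁x → F-extends p (x , p↦ι₁x))
  where
    open Completion C₁ using () renaming (Y to Y₁; ι to ι₁; embedding to ι₁-embedding)
    open Completion C₂ using ()
      renaming (Y to Y₂; ι to ι₂; embedding to ι₂-embedding; multiretr to Y₂-multiretr)

    extension : Σ (Cantor → Carrier Y₂) λ F → IsComputableTotal Y₂ F ×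
                  (∀ p (x,d : NameOfImage X Y₁ ι₁ p) → F p ≡ ι₂ (proj₁ x,d))
    extension = Y₂-multiretr (NameOfImage X Y₁ ι₁) (λ p x,d → ι₂ (proj₁ x,d))
                  (∘-inverse-computable X Y₁ ι₁ {Y₂} {ι₂} ι₁-embedding (proj₁ ι₂-embedding))

    F : Cantor → Carrier Y₂
    F = proj₁ extension

    F-computable : IsComputableTotal Y₂ F
    F-computable = proj₁ (proj₂ extension)

    F-extends : ∀ p (x,d : NameOfImage X Y₁ ι₁ p) → F p ≡ ι₂ (proj₁ x,d)
    F-extends = proj₂ (proj₂ extension)
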